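{- For every finite directed graph $G$ and every $R\subseteq V(G)$, the simplicial complex $\mathrm{DT}_R(G)$ is shellable.
   Context: A directed forest in a directed graph $G$ is a set $F$ of edges of $G$ such that at most one edge of $F$ is directed to each vertex and $F$ contains no directed cycle. The roots of $F$ are the vertices of $G$ with no edge of $F$ directed to them. $\mathrm{DT}(G)$ is the simplicial complex with vertex set $E(G)$ whose faces are the edge sets of directed forests of $G$. For $R\subseteq V(G)$, $\mathrm{DT}_R(G)\subseteq\mathrm{DT}(G)$ is the subcomplex generated by the directed forests whose set of roots is exactly $R$. A simplicial complex is shellable if its maximal faces can be ordered $F_1,\ldots,F_n$ so that for all $1\le i<k\le n$ there are $1\le j<k$ and $e\in F_k$ with $F_i\cap F_k\subseteq F_j\cap F_k=F_k\setminus\{e\}$. -}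

module Defs where

open import Data.Nat using (ℕ; suc)
open import Data.Fin using (Fin; zero; suc; inject₁; fromℕ; _<_)
open import Data.Fin.Subset using (Subset; _∈_; _∉_; _⊆_; _⊂_; _∩_; _-_)
open import Data.Product using (Σ; ∃; ∃-syntax; _×_; _,_)
open import Relation.Binary.PropositionalEquality using (_≡_)
open import Relation.Nullary using (¬_)
open import Function.Definitions using (Injective)
open import Function.Bundles using (_⇔_)

record Digraph : Set where
  field
    nV  : ℕ
    nE  : ℕ
    src : Fin nE → Fin nV
    tgt : Fin nE → Fin nV
open Digraph public

module _ (G : Digraph) where

  InDegAtMostOne : Subset (nE G) → Set
  InDegAtMostOne F = ∀ e f → e ∈ F → f ∈ F → tgt G e ≡ tgt G f → e ≡ f

  HasDirectedCycle : Subset (nE G) → Set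
  HasDirectedCycle F =
    Σ ℕ λ k → Σ (Fin (suc k) → Fin (nE G)) λ c →
      (∀ i → c i ∈ F) ×
      (∀ (i : Fin k) → tgt G (c (inject₁ i)) ≡ src G (c (suc i))) ×
      (tgt G (c (fromℕ k)) ≡ src G (c zero))

  DirectedForest : Subset (nE G) → Set
  DirectedForest F = InDegAtMostOne F × ¬ HasDirectedCycle F

  IsRoot : Subset (nE G) → Fin (nV G) → Set
  IsRoot F v = ¬ (∃[ e ] (e ∈ F × tgt G e ≡ v))

  RootsAre : Subset (nE G) → Subset (nV G) → Set
  RootsAre F R = ∀ v → (v ∈ R ⇔ IsRoot F v)

  DT-R-Face : Subset (nV G) → Subset (nE G) → Set
  DT-R-Face R σ = ∃[ T ] (DirectedForest T × RootsAre T R × σ ⊆ T)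

IsFacet : {m : ℕ} → (Subset m → Set) → Subset m → Set
IsFacet Face σ = Face σ × (∀ τ → Face τ → ¬ (σ ⊂ τ))

Shellable : {m : ℕ} → (Subset m → Set) → Set
Shellable {m} Face =
  Σ ℕ λ N → Σ (Fin N → Subset m) λ F →
    Injective _≡_ _≡_ F ×
    (∀ i → IsFacet Face (F i)) ×
    (∀ σ → IsFacet Face σ → ∃[ i ] (F i ≡ σ)) ×
    (∀ i k → i < k →
       ∃[ j ] (j < k × ∃[ e ] (e ∈ F k ×
         (F i ∩ F k ⊆ F j ∩ F k) × (F j ∩ F k ≡ F k - e))))

-- The facets of DT_R(G) are the directed forests with root set exactly R.  For edge
-- sets Φ and X consider the facets containing Φ and avoiding X.  If there are two of
-- them, T ≠ F₁, take e₀ ∈ T ∖ F₁; on the path of T from R through e₀ let e′ be the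
-- first edge avoided by some facet F₂ of the family, and let e be the edge of F₂
-- entering the head of e′.  In every facet F ∋ e of the family, e can be replaced by
-- e′: the edges of that path before e′ lie in all facets of the family, so every vertex
-- still reaches R.  Hence listing the facets avoiding e before those containing e, each
-- part recursively, is a shelling: a facet F ∋ e meets every earlier facet inside
-- F - e = F ∩ (F - e + e′).
module Submission where

open import Defs
open import Data.Fin.Subset using (Subset)

open import Data.Nat as ℕ using (ℕ; zero; suc; _+_; _∸_)
import Data.Nat.Properties as ℕ
open import Data.Nat.GeneralisedArithmetic using (fold; fold-+)
open import Data.Fin as Fin using (Fin; zero; suc; toℕ; inject₁; fromℕ; fromℕ<; opposite; _<_)
import Data.Fin.Properties as Fin
open import Data.Fin.Subset
  using (⊥; ∁; _∈_; _∉_; _⊆_; _⊂_; _∩_; _∪_; _─_; _-_; ⁅_⁆; ∣_∣)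
open import Data.Fin.Subset.Properties
  using ( _∈?_; _⊆?_; ⊆-antisym; anySubset?; ∉⊥; x∈⁅x⁆; x∈⁅y⁆⇒x≡y
        ; x∈p∩q⁺; x∈p∩q⁻; x∈p∪q⁺; x∈p∪q⁻; p⊆p∪q; x∈p∧x≢y⇒x∈p-y; p─q⊆p
        ; x∈∁p⇒x∉p; x∉p⇒x∈∁p; p⊂q⇒∁p⊃∁q; p⊂q⇒∣p∣<∣q∣ )
open import Data.Vec using (_∷_; here; there)
open import Data.Vec.Properties using (≡-dec)
import Data.Bool.Properties as Bool
open import Data.List using (List; []; _∷_; _++_; length; lookup)
open import Data.List.Membership.Propositional using () renaming (_∈_ to _∈ₗ_)
open import Data.List.Membership.Propositional.Properties
  using (∈-++⁺ˡ; ∈-++⁺ʳ; ∈-++⁻; ∈-lookup)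
open import Data.List.Relation.Unary.All as All using (All; []; _∷_)
open import Data.List.Relation.Unary.Any using (here; index)
open import Data.List.Relation.Unary.Any.Properties using (lookup-index)
open import Data.Product using (∃-syntax; _×_; _,_; proj₁; proj₂)
open import Data.Sum using (_⊎_; inj₁; inj₂)
open import Data.Empty using (⊥-elim)
open import Function using (_∘_; case_of_; _⇔_; mk⇔; Equivalence)
open import Function.Definitions using (Injective)
open import Function.Construct.Composition using (_⇔-∘_)
open import Function.Construct.Symmetry using (⇔-sym)
open import Relation.Binary.PropositionalEquality
open import Relation.Nullary using (¬_; Dec; yes; no; contradiction; ¬?)
open import Relation.Nullary.Decidable as Dec using (_×-dec_; _→-dec_; decidable-stable)
open import Level using (0ℓ)
open import Relation.Unary using (Pred; Decidable)
open import Relation.Binary.Definitions using (tri<; tri≈; tri>)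

x∈q⇒x∉p─q : ∀ {n} (p q : Subset n) {x} → x ∈ q → x ∉ p ─ q
x∈q⇒x∉p─q (_ ∷ p) (_ ∷ q) (there x∈q) (there x∈p─q) = x∈q⇒x∉p─q p q x∈q x∈p─q

_⇔-dec_ : ∀ {A B : Set} → Dec A → Dec B → Dec (A ⇔ B)
A? ⇔-dec B? = Dec.map′ (λ (to , from) → mk⇔ to from) (λ A⇔B → to A⇔B , from A⇔B)
                       ((A? →-dec B?) ×-dec (B? →-dec A?))
  where open Equivalence

∀[P⊎Q]⇒∀P⊎Q : ∀ {n} {P : Pred (Fin n) 0ℓ} {Q : Set} → (∀ i → P i ⊎ Q) → (∀ i → P i) ⊎ Q
∀[P⊎Q]⇒∀P⊎Q {zero}  P⊎Q = inj₁ λ ()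
∀[P⊎Q]⇒∀P⊎Q {suc n} P⊎Q with P⊎Q zero | ∀[P⊎Q]⇒∀P⊎Q (P⊎Q ∘ suc)
... | inj₂ q  | _        = inj₂ q
... | inj₁ _  | inj₂ q   = inj₂ q
... | inj₁ p₀ | inj₁ pₛ  = inj₁ (Fin.∀-cons p₀ pₛ)

module _ {n : ℕ} where

  x∈p-y⇒x≢y : ∀ {p : Subset n} {x y} → x ∈ p - y → x ≢ y
  x∈p-y⇒x≢y {y = y} x∈p-y refl = x∈q⇒x∉p─q _ ⁅ y ⁆ (x∈⁅x⁆ y) x∈p-y

  exchange : Subset n → Fin n → Fin n → Subset n
  exchange F e e′ = (F - e) ∪ ⁅ e′ ⁆

  module _ {F : Subset n} {e e′ : Fin n} where

    ∈-exchange⁻ : ∀ {x} → x ∈ exchange F e e′ → (x ∈ F × x ≢ e) ⊎ x ≡ e′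
    ∈-exchange⁻ {x} x∈ with x∈p∪q⁻ (F - e) ⁅ e′ ⁆ x∈
    ... | inj₁ x∈F-e = inj₁ (p─q⊆p F ⁅ e ⁆ x∈F-e , x∈p-y⇒x≢y x∈F-e)
    ... | inj₂ x∈e′  = inj₂ (x∈⁅y⁆⇒x≡y e′ x∈e′)

    ∈-exchange⁺ : ∀ {x} → x ∈ F → x ≢ e → x ∈ exchange F e e′
    ∈-exchange⁺ x∈F x≢e = x∈p∪q⁺ (inj₁ (x∈p∧x≢y⇒x∈p-y x∈F x≢e))

    e′∈exchange : e′ ∈ exchange F e e′
    e′∈exchange = x∈p∪q⁺ (inj₂ (x∈⁅x⁆ e′))

    e∉exchange : e ∈ F → e′ ∉ F → e ∉ exchange F e e′
    e∉exchange e∈F e′∉F e∈ with ∈-exchange⁻ e∈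
    ... | inj₁ (_ , e≢e) = e≢e refl
    ... | inj₂ refl      = e′∉F e∈F

    exchange-∩ : e′ ∉ F → exchange F e e′ ∩ F ≡ F - e
    exchange-∩ e′∉F = ⊆-antisym ⊆-F-e F-e⊆
      where
      ⊆-F-e : exchange F e e′ ∩ F ⊆ F - e
      ⊆-F-e x∈ with x∈p∩q⁻ (exchange F e e′) F x∈
      ... | x∈exch , x∈F with ∈-exchange⁻ x∈exch
      ...   | inj₁ (_ , x≢e) = x∈p∧x≢y⇒x∈p-y x∈F x≢e
      ...   | inj₂ refl      = contradiction x∈F e′∉F
      F-e⊆ : F - e ⊆ exchange F e e′ ∩ F
      F-e⊆ x∈F-e = x∈p∩q⁺ (x∈p∪q⁺ (inj₁ x∈F-e) , p─q⊆p F ⁅ e ⁆ x∈F-e)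

  ⊈⇒∃∈∉ : ∀ {p q : Subset n} → ¬ p ⊆ q → ∃[ x ] (x ∈ p × x ∉ q)
  ⊈⇒∃∈∉ {p} {q} p⊈q
    with Fin.¬∀⟶∃¬ n (λ x → x ∈ p → x ∈ q) (λ x → x ∈? p →-dec x ∈? q) (λ ⊆ → p⊈q (⊆ _))
  ... | x , x∈p⇏x∈q =
    x , decidable-stable (x ∈? p) (λ x∉p → x∈p⇏x∈q λ x∈p → contradiction x∈p x∉p) ,
    λ x∈q → x∈p⇏x∈q λ _ → x∈q

  x∉q⇒q∩p⊆p-x : ∀ {p q : Subset n} {x} → x ∉ q → q ∩ p ⊆ p - x
  x∉q⇒q∩p⊆p-x {p} {q} x∉q y∈ with x∈p∩q⁻ q p y∈
  ... | y∈q , y∈p = x∈p∧x≢y⇒x∈p-y y∈p λ { refl → x∉q y∈q }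

  ∣∁p∪⁅x⁆∣<∣∁p∣ : ∀ {p : Subset n} {x} → x ∉ p → ∣ ∁ (p ∪ ⁅ x ⁆) ∣ ℕ.< ∣ ∁ p ∣
  ∣∁p∪⁅x⁆∣<∣∁p∣ {p} {x} x∉p =
    p⊂q⇒∣p∣<∣q∣ (p⊂q⇒∁p⊃∁q (p⊆p∪q ⁅ x ⁆ , x , x∈p∪q⁺ (inj₂ (x∈⁅x⁆ x)) , x∉p))

module _ {n : ℕ} where

  ThroughRidge : Subset n → Subset n → Subset n → Set
  ThroughRidge F′ G F = ∃[ e ] (e ∈ F × F′ ∩ F ⊆ G ∩ F × G ∩ F ≡ F - e)

  Attaches : List (Subset n) → Subset n → Set
  Attaches Fs F = ∀ {F′} → F′ ∈ₗ Fs → ∃[ G ] (G ∈ₗ Fs × ThroughRidge F′ G F)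

  -- Facets are listed latest first: each one attaches to those after it.
  data Shelling : List (Subset n) → Set where
    []  : Shelling []
    _∷_ : ∀ {F Fs} → Attaches Fs F → Shelling Fs → Shelling (F ∷ Fs)

  attaches-++ : ∀ {Fs Gs F} → Attaches Fs F → Attaches Gs F → Attaches (Fs ++ Gs) F
  attaches-++ {Fs} attF attG F′∈ with ∈-++⁻ Fs F′∈
  ... | inj₁ F′∈Fs = let G , G∈ , ridge = attF F′∈Fs in G , ∈-++⁺ˡ G∈ , ridge
  ... | inj₂ F′∈Gs = let G , G∈ , ridge = attG F′∈Gs in G , ∈-++⁺ʳ Fs G∈ , ridge

  shelling-++ : ∀ {Fs Gs} → Shelling Fs → Shelling Gs → All (Attaches Gs) Fs →
                Shelling (Fs ++ Gs)
  shelling-++ []          shG []             = shG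
  shelling-++ (att ∷ shF) shG (attG ∷ attsG) = attaches-++ att attG ∷ shelling-++ shF shG attsG

  attaches-by-exchange : ∀ {Gs F e e′} → e ∈ F → e′ ∉ F → exchange F e e′ ∈ₗ Gs →
                         (∀ {G} → G ∈ₗ Gs → e ∉ G) → Attaches Gs F
  attaches-by-exchange {F = F} {e} {e′} e∈F e′∉F exch∈ e∉Gs {F′} F′∈ =
    exchange F e e′ , exch∈ , e , e∈F ,
    subst (F′ ∩ F ⊆_) (sym (exchange-∩ e′∉F)) (x∉q⇒q∩p⊆p-x (e∉Gs F′∈)) , exchange-∩ e′∉F

  shelling-lookup : ∀ {Fs} → Shelling Fs → ∀ {p q : Fin (length Fs)} → p < q →
                    ∃[ r ] (p < r × ThroughRidge (lookup Fs q) (lookup Fs r) (lookup Fs p))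
  shelling-lookup (att ∷ sh) {zero} {suc q} p<q =
    let G , G∈ , ridge = att (∈-lookup q)
    in suc (index G∈) , ℕ.z<s , subst (λ G → ThroughRidge _ G _) (lookup-index G∈) ridge
  shelling-lookup (att ∷ sh) {suc p} {suc q} p<q =
    let r , p<r , ridge = shelling-lookup sh (ℕ.s<s⁻¹ p<q) in suc r , ℕ.s<s p<r , ridge

  record ShellingOf (Q : Subset n → Set) : Set where
    field
      facets   : List (Subset n)
      members  : ∀ F → Q F ⇔ F ∈ₗ facets
      shelling : Shelling facets

  shellingOf-empty : ∀ {Q : Subset n → Set} → (∀ {F} → ¬ Q F) → ShellingOf Q
  shellingOf-empty ∄F = record
    { facets   = []
    ; members  = λ F → mk⇔ (⊥-elim ∘ ∄F) λ ()
    ; shelling = []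
    }

  shellingOf-singleton : ∀ {Q : Subset n → Set} {F} → Q F → (∀ {F′} → Q F′ → F′ ≡ F) →
                         ShellingOf Q
  shellingOf-singleton {F = F} QF unique = record
    { facets   = F ∷ []
    ; members  = λ F′ → mk⇔ (here ∘ unique) λ { (here refl) → QF }
    ; shelling = (λ ()) ∷ []
    }

  shellingOf-⇔ : ∀ {Q Q′ : Subset n → Set} → (∀ F → Q F ⇔ Q′ F) →
                 ShellingOf Q → ShellingOf Q′
  shellingOf-⇔ Q⇔Q′ shellingOfQ = record
    { facets   = facets
    ; members  = λ F → members F ⇔-∘ ⇔-sym (Q⇔Q′ F)
    ; shelling = shelling
    }
    where open ShellingOf shellingOfQ

  ShellingOrder : ∀ {N} → (Fin N → Subset n) → Set
  ShellingOrder {N} F = ∀ i k → i < k → ∃[ j ] (j < k × ThroughRidge (F i) (F j) (F k))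

  shellingOrder-distinct : ∀ {N} {F : Fin N → Subset n} → ShellingOrder F →
                           ∀ {i k} → i < k → F i ≢ F k
  shellingOrder-distinct order i<k Fi≡Fk with order _ _ i<k
  ... | _ , _ , e , e∈Fk , Fi∩Fk⊆ , ridge≡ = x∈p-y⇒x≢y e∈Fk-e refl
    where
    e∈Fk-e = subst (e ∈_) ridge≡ (Fi∩Fk⊆ (x∈p∩q⁺ (subst (e ∈_) (sym Fi≡Fk) e∈Fk , e∈Fk)))

  shellingOrder⇒injective : ∀ {N} {F : Fin N → Subset n} → ShellingOrder F →
                            Injective _≡_ _≡_ F
  shellingOrder⇒injective order {i} {k} Fi≡Fk with Fin.<-cmp i k
  ... | tri< i<k _ _ = contradiction Fi≡Fk (shellingOrder-distinct order i<k)
  ... | tri≈ _ i≡k _ = i≡k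
  ... | tri> _ _ k<i = contradiction (sym Fi≡Fk) (shellingOrder-distinct order k<i)

opposite-< : ∀ {N} {i k : Fin N} → i < k → opposite k < opposite i
opposite-< {N} {i} {k} i<k = subst₂ ℕ._<_ (sym (Fin.opposite-prop k)) (sym (Fin.opposite-prop i))
  (ℕ.∸-monoʳ-< (ℕ.s<s i<k) (Fin.toℕ<n k))

shellable : ∀ {n} {Face : Subset n → Set} → ShellingOf (IsFacet Face) → Shellable Face
shellable {Face = Face} shellingOfFacets =
  length facets , F , shellingOrder⇒injective order , isFacet , cover , order
  where
  open ShellingOf shellingOfFacets
  F : Fin (length facets) → Subset _
  F i = lookup facets (opposite i)
  lookup≡F : ∀ p → lookup facets p ≡ F (opposite p)
  lookup≡F p = cong (lookup facets) (sym (Fin.opposite-involutive p))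
  order : ShellingOrder F
  order i k i<k with shelling-lookup shelling (opposite-< i<k)
  ... | r , k′<r , ridge =
    opposite r , subst (opposite r <_) (Fin.opposite-involutive k) (opposite-< k′<r) ,
    subst (λ G → ThroughRidge _ G _) (lookup≡F r) ridge
  isFacet : ∀ i → IsFacet Face (F i)
  isFacet i = Equivalence.from (members (F i)) (∈-lookup (opposite i))
  cover : ∀ σ → IsFacet Face σ → ∃[ i ] (F i ≡ σ)
  cover σ σ-facet =
    let σ∈ = Equivalence.to (members σ) σ-facet
    in opposite (index σ∈) , sym (trans (lookup-index σ∈) (lookup≡F (index σ∈)))

module Shedding {n : ℕ} {P : Subset n → Set} (P? : Decidable P) where

  Restricted : Subset n → Subset n → Subset n → Set
  Restricted Φ X F = P F × Φ ⊆ F × F ⊆ ∁ X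

  restricted? : ∀ Φ X → Decidable (Restricted Φ X)
  restricted? Φ X F = P? F ×-dec Φ ⊆? F ×-dec F ⊆? ∁ X

  IsShedding : Subset n → Subset n → Fin n → Set
  IsShedding Φ X e =
    ∀ {F} → Restricted Φ X F → e ∈ F → ∃[ e′ ] (e′ ∉ F × Restricted Φ X (exchange F e e′))

  module _ {Φ X : Subset n} {e : Fin n} where

    contain⁺ : ∀ {F} → Restricted Φ X F → e ∈ F → Restricted (Φ ∪ ⁅ e ⁆) X F
    contain⁺ {F} (PF , Φ⊆F , F⊆∁X) e∈F = PF , Φ∪e⊆F , F⊆∁X
      where
      Φ∪e⊆F : Φ ∪ ⁅ e ⁆ ⊆ F
      Φ∪e⊆F x∈ with x∈p∪q⁻ Φ ⁅ e ⁆ x∈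
      ... | inj₁ x∈Φ = Φ⊆F x∈Φ
      ... | inj₂ x∈e rewrite x∈⁅y⁆⇒x≡y e x∈e = e∈F

    contain⁻ : ∀ {F} → Restricted (Φ ∪ ⁅ e ⁆) X F → Restricted Φ X F × e ∈ F
    contain⁻ (PF , Φ∪e⊆F , F⊆∁X) =
      (PF , Φ∪e⊆F ∘ x∈p∪q⁺ ∘ inj₁ , F⊆∁X) , Φ∪e⊆F (x∈p∪q⁺ (inj₂ (x∈⁅x⁆ e)))

    avoid⁺ : ∀ {F} → Restricted Φ X F → e ∉ F → Restricted Φ (X ∪ ⁅ e ⁆) F
    avoid⁺ {F} (PF , Φ⊆F , F⊆∁X) e∉F = PF , Φ⊆F , F⊆∁X∪e
      where
      F⊆∁X∪e : F ⊆ ∁ (X ∪ ⁅ e ⁆)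
      F⊆∁X∪e {x} x∈F = x∉p⇒x∈∁p λ x∈ → case x∈p∪q⁻ X ⁅ e ⁆ x∈ of λ where
        (inj₁ x∈X) → x∈∁p⇒x∉p (F⊆∁X x∈F) x∈X
        (inj₂ x∈e) → e∉F (subst (_∈ F) (x∈⁅y⁆⇒x≡y e x∈e) x∈F)

    avoid⁻ : ∀ {F} → Restricted Φ (X ∪ ⁅ e ⁆) F → Restricted Φ X F × e ∉ F
    avoid⁻ (PF , Φ⊆F , F⊆∁X∪e) =
      (PF , Φ⊆F , λ x∈F → x∉p⇒x∈∁p (x∈∁p⇒x∉p (F⊆∁X∪e x∈F) ∘ x∈p∪q⁺ ∘ inj₁)) ,
      λ e∈F → x∈∁p⇒x∉p (F⊆∁X∪e e∈F) (x∈p∪q⁺ (inj₂ (x∈⁅x⁆ e)))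

    shellingOf-split : IsShedding Φ X e → ShellingOf (Restricted Φ (X ∪ ⁅ e ⁆)) →
                       ShellingOf (Restricted (Φ ∪ ⁅ e ⁆) X) → ShellingOf (Restricted Φ X)
    shellingOf-split shed avoiding containing = record
      { facets   = facets containing ++ facets avoiding
      ; members  = λ F → mk⇔ (member⁺ F) member⁻
      ; shelling = shelling-++ (shelling containing) (shelling avoiding) (All.tabulate attaches)
      }
      where
      open ShellingOf
      member⁺ : ∀ F → Restricted Φ X F → F ∈ₗ facets containing ++ facets avoiding
      member⁺ F rF with e ∈? F
      ... | yes e∈F = ∈-++⁺ˡ (Equivalence.to (members containing F) (contain⁺ rF e∈F))
      ... | no  e∉F =
        ∈-++⁺ʳ (facets containing) (Equivalence.to (members avoiding F) (avoid⁺ rF e∉F))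
      member⁻ : ∀ {F} → F ∈ₗ facets containing ++ facets avoiding → Restricted Φ X F
      member⁻ {F} F∈ with ∈-++⁻ (facets containing) F∈
      ... | inj₁ F∈c = proj₁ (contain⁻ (Equivalence.from (members containing F) F∈c))
      ... | inj₂ F∈a = proj₁ (avoid⁻ (Equivalence.from (members avoiding F) F∈a))
      attaches : ∀ {F} → F ∈ₗ facets containing → Attaches (facets avoiding) F
      attaches {F} F∈ with contain⁻ (Equivalence.from (members containing F) F∈)
      ... | rF , e∈F with shed rF e∈F
      ...   | e′ , e′∉F , rExch =
        attaches-by-exchange e∈F e′∉F
          (Equivalence.to (members avoiding _) (avoid⁺ rExch (e∉exchange e∈F e′∉F)))
          (λ {G} G∈ → proj₂ (avoid⁻ (Equivalence.from (members avoiding G) G∈)))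

  freedom : Subset n → Subset n → ℕ
  freedom Φ X = ∣ ∁ Φ ∣ + ∣ ∁ X ∣

  freedom-Φ : ∀ {Φ X e} → e ∉ Φ → freedom (Φ ∪ ⁅ e ⁆) X ℕ.< freedom Φ X
  freedom-Φ {X = X} e∉Φ = ℕ.+-monoˡ-< ∣ ∁ X ∣ (∣∁p∪⁅x⁆∣<∣∁p∣ e∉Φ)

  freedom-X : ∀ {Φ X e} → e ∉ X → freedom Φ (X ∪ ⁅ e ⁆) ℕ.< freedom Φ X
  freedom-X {Φ} e∉X = ℕ.+-monoʳ-< ∣ ∁ Φ ∣ (∣∁p∪⁅x⁆∣<∣∁p∣ e∉X)

  module _ (shedding : ∀ {Φ X F F′} → Restricted Φ X F → Restricted Φ X F′ → F ≢ F′ →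
                       ∃[ e ] (e ∉ Φ × e ∉ X × IsShedding Φ X e)) where

    shellingOf-restricted : ∀ k {Φ X} → freedom Φ X ℕ.≤ k → ShellingOf (Restricted Φ X)
    shellingOf-restricted k {Φ} {X} bound with anySubset? (restricted? Φ X)
    ... | no ∄F = shellingOf-empty λ rF → ∄F (_ , rF)
    ... | yes (F , rF) with anySubset? (λ F′ → restricted? Φ X F′ ×-dec ¬? (≡-dec Bool._≟_ F F′))
    ...   | no ∄F′ = shellingOf-singleton rF λ {F′} rF′ →
      decidable-stable (≡-dec Bool._≟_ F′ F) λ F′≢F → ∄F′ (F′ , rF′ , F′≢F ∘ sym)
    ...   | yes (F′ , rF′ , F≢F′) with shedding rF rF′ F≢F′ | k
    ...     | e , e∉Φ , e∉X , shed | zero  = contradiction (ℕ.<-≤-trans (freedom-Φ {X = X} e∉Φ) bound) ℕ.n≮0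
    ...     | e , e∉Φ , e∉X , shed | suc k = shellingOf-split shed
      (shellingOf-restricted k (ℕ.s≤s⁻¹ (ℕ.<-≤-trans (freedom-X {Φ} e∉X) bound)))
      (shellingOf-restricted k (ℕ.s≤s⁻¹ (ℕ.<-≤-trans (freedom-Φ {X = X} e∉Φ) bound)))

    shellingOf : ShellingOf P
    shellingOf = shellingOf-⇔ (λ F → mk⇔ proj₁ unrestricted) (shellingOf-restricted _ ℕ.≤-refl)
      where
      unrestricted : ∀ {F} → P F → Restricted ⊥ ⊥ F
      unrestricted PF = PF , (λ x∈⊥ → contradiction x∈⊥ ∉⊥) , λ _ → x∉p⇒x∈∁p ∉⊥

module Forests (G : Digraph) (R : Subset (nV G)) where

  private
    V = Fin (nV G)
    E = Fin (nE G)
    variable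
      F : Subset (nE G)
      v : V

  RootedForest : Subset (nE G) → Set
  RootedForest F = DirectedForest G F × RootsAre G F R

  data Reach (P : Pred E 0ℓ) : V → Set where
    root : v ∈ R → Reach P v
    step : ∀ {e} → P e → Reach P (src G e) → Reach P (tgt G e)

  Reach-map : ∀ {P Q : Pred E 0ℓ} → (∀ {e} → P e → Q e) → Reach P v → Reach Q v
  Reach-map P⇒Q (root v∈R)   = root v∈R
  Reach-map P⇒Q (step Pe r) = step (P⇒Q Pe) (Reach-map P⇒Q r)

  Reach-split : ∀ {P Q Q′ : Pred E 0ℓ} → (∀ e → Q e ⊎ Q′ e) → Reach P v →
                Reach (λ e → P e × Q e) v ⊎
                ∃[ e ] (P e × Q′ e × Reach (λ e → P e × Q e) (src G e))
  Reach-split Q⊎Q′ (root v∈R) = inj₁ (root v∈R)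
  Reach-split Q⊎Q′ (step {e} Pe r) with Reach-split Q⊎Q′ r
  ... | inj₂ exit = inj₂ exit
  ... | inj₁ rQ with Q⊎Q′ e
  ...   | inj₁ Qe  = inj₁ (step (Pe , Qe) rQ)
  ...   | inj₂ Q′e = inj₂ (e , Pe , Q′e , rQ)

  Reaches : Subset (nE G) → Set
  Reaches F = ∀ v → Reach (_∈ F) v

  reaches⇒acyclic : InDegAtMostOne G F → RootsAre G F R → Reaches F →
                    ¬ HasDirectedCycle G F
  reaches⇒acyclic {F} indeg roots reaches (k , c , c∈F , c-step , c-close) =
    noReach (reaches (src G (c zero))) zero refl
    where
    pred : ∀ i → ∃[ j ] (tgt G (c j) ≡ src G (c i))
    pred zero    = fromℕ k , c-close
    pred (suc i) = inject₁ i , c-step i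
    -- With in-degree at most one, an F-path into a vertex of the cycle runs backwards
    -- along the cycle for ever, so it cannot start at a root.
    noReach : Reach (_∈ F) v → ∀ i → src G (c i) ≢ v
    noReach (root v∈R) i refl =
      let j , cj↦ci = pred i in Equivalence.to (roots _) v∈R (c j , c∈F j , cj↦ci)
    noReach (step e∈F r) i eq with pred i
    ... | j , cj↦ci with indeg _ (c j) e∈F (c∈F j) (sym (trans cj↦ci eq))
    ...   | refl = noReach r j refl

  HasParent : Subset (nE G) → V → Set
  HasParent F v = ∃[ e ] (e ∈ F × tgt G e ≡ v)

  hasParent? : ∀ F v → Dec (HasParent F v)
  hasParent? F v = Fin.any? λ e → e ∈? F ×-dec tgt G e Fin.≟ v

  nonRoot⇒hasParent : RootsAre G F R → v ∉ R → HasParent F v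
  nonRoot⇒hasParent {F} {v} roots v∉R =
    decidable-stable (hasParent? F v) (v∉R ∘ Equivalence.from (roots v))

  module Ancestors {F : Subset (nE G)} (roots : RootsAre G F R) where

    -- the edge of F entering src e, or the junk value e when src e ∈ R
    parentEdge : E → E
    parentEdge e with src G e ∈? R
    ... | yes _   = e
    ... | no  s∉R = proj₁ (nonRoot⇒hasParent roots s∉R)

    parentEdge-∈ : ∀ {e} → e ∈ F → parentEdge e ∈ F
    parentEdge-∈ {e} e∈F with src G e ∈? R
    ... | yes _   = e∈F
    ... | no  s∉R = proj₁ (proj₂ (nonRoot⇒hasParent roots s∉R))

    tgt-parentEdge : ∀ {e} → src G e ∉ R → tgt G (parentEdge e) ≡ src G e
    tgt-parentEdge {e} s∉R with src G e ∈? R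
    ... | yes s∈R  = contradiction s∈R s∉R
    ... | no  s∉R′ = proj₂ (proj₂ (nonRoot⇒hasParent roots s∉R′))

    ancestor : ℕ → E → E
    ancestor t e = fold e parentEdge t

    ancestor-∈ : ∀ t {e} → e ∈ F → ancestor t e ∈ F
    ancestor-∈ zero    e∈F = e∈F
    ancestor-∈ (suc t) e∈F = parentEdge-∈ (ancestor-∈ t e∈F)

    reach-parentEdge : ∀ {e} → e ∈ F → Reach (_∈ F) (src G (parentEdge e)) →
                       Reach (_∈ F) (src G e)
    reach-parentEdge {e} e∈F r = viaParent (src G e ∈? R)
      where
      viaParent : Dec (src G e ∈ R) → Reach (_∈ F) (src G e)
      viaParent (yes s∈R) = root s∈R
      viaParent (no s∉R)  = subst (Reach _) (tgt-parentEdge s∉R) (step (parentEdge-∈ e∈F) r)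

    reach-ancestor : ∀ t {e} → e ∈ F → Reach (_∈ F) (src G (ancestor t e)) →
                     Reach (_∈ F) (src G e)
    reach-ancestor zero    e∈F r = r
    reach-ancestor (suc t) e∈F r = reach-ancestor t e∈F (reach-parentEdge (ancestor-∈ t e∈F) r)

    periodic⇒cycle : ∀ k {u} → u ∈ F → ancestor (suc k) u ≡ u →
                     (∀ s → s ℕ.≤ k → src G (ancestor s u) ∉ R) → HasDirectedCycle G F
    periodic⇒cycle k {u} u∈F loop nonRoot =
      k , c , (λ i → ancestor-∈ (k ∸ toℕ i) u∈F) , c-step , c-close
      where
      open ≡-Reasoning
      -- ancestors run against the edges, so the cycle lists them backwards
      c : Fin (suc k) → E
      c i = ancestor (k ∸ toℕ i) u
      head : ℕ → V
      head s = tgt G (ancestor s u)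
      head-suc : ∀ s → s ℕ.≤ k → head (suc s) ≡ src G (ancestor s u)
      head-suc s s≤k = tgt-parentEdge (nonRoot s s≤k)
      c-step : ∀ (i : Fin k) → tgt G (c (inject₁ i)) ≡ src G (c (suc i))
      c-step i = begin
        head (k ∸ toℕ (inject₁ i))     ≡⟨ cong (head ∘ (k ∸_)) (Fin.toℕ-inject₁ i) ⟩
        head (k ∸ toℕ i)               ≡⟨ cong head (ℕ.+-∸-assoc 1 (Fin.toℕ<n i)) ⟩
        head (suc (k ∸ suc (toℕ i)))   ≡⟨ head-suc _ (ℕ.m∸n≤m k (suc (toℕ i))) ⟩
        src G (c (suc i))              ∎
      c-close : tgt G (c (fromℕ k)) ≡ src G (c zero)
      c-close = begin
        head (k ∸ toℕ (fromℕ k))  ≡⟨ cong (head ∘ (k ∸_)) (Fin.toℕ-fromℕ k) ⟩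
        head (k ∸ k)              ≡⟨ cong head (ℕ.n∸n≡0 k) ⟩
        tgt G u                   ≡⟨ cong (tgt G) loop ⟨
        head (suc k)              ≡⟨ head-suc k ℕ.≤-refl ⟩
        src G (c zero)            ∎

    -- Among the first nE + 1 ancestors of e₀ two coincide, closing a cycle.
    unrooted⇒cycle : ∀ {e₀} → e₀ ∈ F →
                     (∀ (t : Fin (suc (nE G))) → src G (ancestor (toℕ t) e₀) ∉ R) →
                     HasDirectedCycle G F
    unrooted⇒cycle {e₀} e₀∈F noRoot
      with Fin.pigeonhole (ℕ.n<1+n (nE G)) (λ t → ancestor (toℕ t) e₀)
    ... | i , j , i<j , same with ℕ.m≤n⇒∃[o]m+o≡n i<j
    ... | k , i+1+k≡j = periodic⇒cycle k (ancestor-∈ (toℕ i) e₀∈F) loop nonRoot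
      where
      open ≡-Reasoning
      u : E
      u = ancestor (toℕ i) e₀
      shift : ∀ s → ancestor s u ≡ ancestor (s + toℕ i) e₀
      shift s = sym (fold-+ e₀ parentEdge s)
      period : suc k + toℕ i ≡ toℕ j
      period = trans (cong suc (ℕ.+-comm k (toℕ i))) i+1+k≡j
      loop : ancestor (suc k) u ≡ u
      loop = begin
        ancestor (suc k) u            ≡⟨ shift (suc k) ⟩
        ancestor (suc k + toℕ i) e₀   ≡⟨ cong (λ s → ancestor s e₀) period ⟩
        ancestor (toℕ j) e₀           ≡⟨ same ⟨
        u                             ∎
      nonRoot : ∀ s → s ℕ.≤ k → src G (ancestor s u) ∉ R
      nonRoot s s≤k rewrite shift s =
        subst (λ t → src G (ancestor t e₀) ∉ R) (Fin.toℕ-fromℕ< s+i<) (noRoot (fromℕ< s+i<))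
        where
        s+i< : s + toℕ i ℕ.< suc (nE G)
        s+i< = ℕ.<-trans (ℕ.s≤s (ℕ.+-monoˡ-≤ (toℕ i) s≤k))
                         (subst (ℕ._< suc (nE G)) (sym period) (Fin.toℕ<n j))

    reach-or-cycle : ∀ v → Reach (_∈ F) v ⊎ HasDirectedCycle G F
    reach-or-cycle v with v ∈? R
    ... | yes v∈R = inj₁ (root v∈R)
    ... | no  v∉R with nonRoot⇒hasParent roots v∉R
    ...   | e₀ , e₀∈F , refl with Fin.any? (λ t → src G (ancestor (toℕ t) e₀) ∈? R)
    ...     | yes (t , s∈R) = inj₁ (step e₀∈F (reach-ancestor (toℕ t) e₀∈F (root s∈R)))
    ...     | no  ∄t        = inj₂ (unrooted⇒cycle e₀∈F λ t s∈R → ∄t (t , s∈R))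

  open Ancestors using (reach-or-cycle)

  rootedForest⇒reaches : RootedForest F → Reaches F
  rootedForest⇒reaches ((_ , acyclic) , roots) v with reach-or-cycle roots v
  ... | inj₁ reach = reach
  ... | inj₂ cycle = contradiction cycle acyclic

  inDegAtMostOne? : ∀ F → Dec (InDegAtMostOne G F)
  inDegAtMostOne? F = Fin.all? λ e → Fin.all? λ f →
    e ∈? F →-dec (f ∈? F →-dec (tgt G e Fin.≟ tgt G f →-dec e Fin.≟ f))

  rootsAre? : ∀ F → Dec (RootsAre G F R)
  rootsAre? F = Fin.all? λ v → (v ∈? R) ⇔-dec ¬? (hasParent? F v)

  rootedForest? : Decidable RootedForest
  rootedForest? F with inDegAtMostOne? F | rootsAre? F
  ... | no ¬indeg | _         = no (¬indeg ∘ proj₁ ∘ proj₁)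
  ... | yes _     | no ¬roots = no (¬roots ∘ proj₂)
  ... | yes indeg | yes roots with ∀[P⊎Q]⇒∀P⊎Q (reach-or-cycle roots)
  ...   | inj₁ reaches = yes ((indeg , reaches⇒acyclic indeg roots reaches) , roots)
  ...   | inj₂ cycle   = no λ ((_ , acyclic) , _) → acyclic cycle

  rootedForest-⊆⇒⊇ : ∀ {T T′} → RootedForest T → RootedForest T′ → T ⊆ T′ → T′ ⊆ T
  rootedForest-⊆⇒⊇ {T} (_ , roots) ((indeg′ , _) , roots′) T⊆T′ {x} x∈T′ =
    let y , y∈T , y↦ = nonRoot⇒hasParent roots tgt∉R
    in subst (_∈ T) (indeg′ y x (T⊆T′ y∈T) x∈T′ y↦) y∈T
    where
    tgt∉R : tgt G x ∉ R
    tgt∉R tgt∈R = Equivalence.to (roots′ _) tgt∈R (x , x∈T′ , refl)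

  isFacet⇔rootedForest : ∀ σ → IsFacet (DT-R-Face G R) σ ⇔ RootedForest σ
  isFacet⇔rootedForest σ = mk⇔ to from
    where
    to : IsFacet (DT-R-Face G R) σ → RootedForest σ
    to ((T , forest , roots , σ⊆T) , maximal) = subst RootedForest (sym σ≡T) (forest , roots)
      where
      T⊆σ : T ⊆ σ
      T⊆σ {x} x∈T = decidable-stable (x ∈? σ) λ x∉σ →
        maximal T (T , forest , roots , λ x∈ → x∈) (σ⊆T , x , x∈T , x∉σ)
      σ≡T : σ ≡ T
      σ≡T = ⊆-antisym σ⊆T T⊆σ
    from : RootedForest σ → IsFacet (DT-R-Face G R) σ
    from (forest , roots) = (σ , forest , roots , λ x∈ → x∈) , maximal
      where
      maximal : ∀ τ → DT-R-Face G R τ → ¬ (σ ⊂ τ)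
      maximal τ (T , forest′ , roots′ , τ⊆T) (σ⊆τ , x , x∈τ , x∉σ) =
        x∉σ (rootedForest-⊆⇒⊇ (forest , roots) (forest′ , roots′) (τ⊆T ∘ σ⊆τ) (τ⊆T x∈τ))

  module _ {F : Subset (nE G)} {e e′ : E} (e∈F : e ∈ F) (same-tgt : tgt G e ≡ tgt G e′) where

    exchange-inDeg : InDegAtMostOne G F → InDegAtMostOne G (exchange F e e′)
    exchange-inDeg indeg x y x∈ y∈ x↦y with ∈-exchange⁻ x∈ | ∈-exchange⁻ y∈
    ... | inj₁ (x∈F , _)   | inj₁ (y∈F , _)   = indeg x y x∈F y∈F x↦y
    ... | inj₁ (x∈F , x≢e) | inj₂ refl        =
      contradiction (indeg x e x∈F e∈F (trans x↦y (sym same-tgt))) x≢e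
    ... | inj₂ refl        | inj₁ (y∈F , y≢e) =
      contradiction (indeg y e y∈F e∈F (trans (sym x↦y) (sym same-tgt))) y≢e
    ... | inj₂ refl        | inj₂ refl        = refl

    exchange-isRoot : ∀ v → IsRoot G F v ⇔ IsRoot G (exchange F e e′) v
    exchange-isRoot v = mk⇔ to from
      where
      to : IsRoot G F v → IsRoot G (exchange F e e′) v
      to isRoot (x , x∈ , x↦v) with ∈-exchange⁻ x∈
      ... | inj₁ (x∈F , _) = isRoot (x , x∈F , x↦v)
      ... | inj₂ refl      = isRoot (e , e∈F , trans same-tgt x↦v)
      from : IsRoot G (exchange F e e′) v → IsRoot G F v
      from isRoot (x , x∈F , x↦v) with x Fin.≟ e
      ... | yes refl = isRoot (e′ , e′∈exchange , trans (sym same-tgt) x↦v)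
      ... | no  x≢e  = isRoot (x , ∈-exchange⁺ x∈F x≢e , x↦v)

    exchange-roots : RootsAre G F R → RootsAre G (exchange F e e′) R
    exchange-roots roots v = exchange-isRoot v ⇔-∘ roots v

    exchange-reach : Reach (_∈ exchange F e e′) (tgt G e) → Reach (_∈ F) v →
                     Reach (_∈ exchange F e e′) v
    exchange-reach reach-e (root v∈R) = root v∈R
    exchange-reach reach-e (step {x} x∈F r) with x Fin.≟ e
    ... | yes refl = reach-e
    ... | no  x≢e  = step (∈-exchange⁺ x∈F x≢e) (exchange-reach reach-e r)

    exchange-rootedForest : RootedForest F → Reach (_∈ exchange F e e′) (src G e′) →
                            RootedForest (exchange F e e′)
    exchange-rootedForest forest@((indeg , _) , roots) reach-e′ =
      (indeg′ , reaches⇒acyclic indeg′ roots′ reaches) , roots′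
      where
      indeg′ = exchange-inDeg indeg
      roots′ = exchange-roots roots
      reaches : Reaches (exchange F e e′)
      reaches v = exchange-reach (subst (Reach _) (sym same-tgt) (step e′∈exchange reach-e′))
                                 (rootedForest⇒reaches forest v)

  open Shedding rootedForest?

  module _ {Φ X : Subset (nE G)} where

    Fixed : E → Set
    Fixed e = ∀ {F} → Restricted Φ X F → e ∈ F

    Avoidable : E → Set
    Avoidable e = ∃[ F ] (Restricted Φ X F × e ∉ F)

    fixed-or-avoidable : ∀ e → Fixed e ⊎ Avoidable e
    fixed-or-avoidable e with anySubset? (λ F → restricted? Φ X F ×-dec ¬? (e ∈? F))
    ... | yes avoidable = inj₂ avoidable
    ... | no  ¬avoidable =
      inj₁ λ {F} rF → decidable-stable (e ∈? F) λ e∉F → ¬avoidable (F , rF , e∉F)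

    -- The T-path to src e′ consists of fixed edges other than e, so it survives in
    -- exchange F e e′.
    rerouting-shedding : ∀ {T e e′} → Restricted Φ X T → e′ ∈ T →
                         Reach (λ d → d ∈ T × Fixed d) (src G e′) →
                         tgt G e ≡ tgt G e′ → e ∉ T → IsShedding Φ X e
    rerouting-shedding {T} {e} {e′} (_ , Φ⊆T , T⊆∁X) e′∈T fixedPath same-tgt e∉T
                       {F} rF@(forest@((indeg , _) , _) , Φ⊆F , F⊆∁X) e∈F =
      e′ , e′∉F , exchange-rootedForest e∈F same-tgt forest reach-e′ , Φ⊆F′ , F′⊆∁X
      where
      e′∉F : e′ ∉ F
      e′∉F e′∈F = e∉T (subst (_∈ T) (sym (indeg e e′ e∈F e′∈F same-tgt)) e′∈T)
      reach-e′ : Reach (_∈ exchange F e e′) (src G e′)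
      reach-e′ = Reach-map (λ (d∈T , fixed) → ∈-exchange⁺ (fixed rF) λ d≡e → e∉T (subst (_∈ T) d≡e d∈T))
                           fixedPath
      Φ⊆F′ : Φ ⊆ exchange F e e′
      Φ⊆F′ x∈Φ = ∈-exchange⁺ (Φ⊆F x∈Φ) λ x≡e → e∉T (subst (_∈ T) x≡e (Φ⊆T x∈Φ))
      F′⊆∁X : exchange F e e′ ⊆ ∁ X
      F′⊆∁X x∈ with ∈-exchange⁻ x∈
      ... | inj₁ (x∈F , _) = F⊆∁X x∈F
      ... | inj₂ refl      = T⊆∁X e′∈T

    entering-shedding : ∀ {T e′} → Restricted Φ X T → e′ ∈ T → Avoidable e′ →
                        Reach (λ d → d ∈ T × Fixed d) (src G e′) →
                        ∃[ e ] (e ∉ Φ × e ∉ X × IsShedding Φ X e)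
    entering-shedding {T} {e′} rT@(((indegT , _) , rootsT) , Φ⊆T , _) e′∈T
                      (F₂ , ((_ , roots₂) , _ , F₂⊆∁X) , e′∉F₂) fixedPath
      with nonRoot⇒hasParent roots₂ (λ tgt∈R → Equivalence.to (rootsT _) tgt∈R (e′ , e′∈T , refl))
    ... | e , e∈F₂ , same-tgt =
      e , e∉T ∘ Φ⊆T , x∈∁p⇒x∉p (F₂⊆∁X e∈F₂) , rerouting-shedding rT e′∈T fixedPath same-tgt e∉T
      where
      e∉T : e ∉ T
      e∉T e∈T = e′∉F₂ (subst (_∈ F₂) (indegT e e′ e∈T e′∈T same-tgt) e∈F₂)

    rootedForest-shedding : ∀ {T F₁} → Restricted Φ X T → Restricted Φ X F₁ → T ≢ F₁ →
                            ∃[ e ] (e ∉ Φ × e ∉ X × IsShedding Φ X e)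
    rootedForest-shedding rT@(forestT , _) rF₁@(forest₁ , _) T≢F₁
      with ⊈⇒∃∈∉ (λ T⊆F₁ → T≢F₁ (⊆-antisym T⊆F₁ (rootedForest-⊆⇒⊇ forestT forest₁ T⊆F₁)))
    ... | e₀ , e₀∈T , e₀∉F₁
      with Reach-split fixed-or-avoidable (rootedForest⇒reaches forestT (src G e₀))
    ...   | inj₁ fixedPath                       = entering-shedding rT e₀∈T (_ , rF₁ , e₀∉F₁) fixedPath
    ...   | inj₂ (e′ , e′∈T , avoid , fixedPath) = entering-shedding rT e′∈T avoid fixedPath

theorem2p9 : (G : Digraph) (R : Subset (nV G)) → Shellable (DT-R-Face G R)
theorem2p9 G R =
  shellable (shellingOf-⇔ (⇔-sym ∘ isFacet⇔rootedForest) (shellingOf rootedForest-shedding))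
  where
  open Forests G R
  open Shedding rootedForest?
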